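{- Let $m\le n$ and let $Q\in\mathbb{R}^{m\times n}$ with $QQ^T=I$ have the block form $Q=\begin{bmatrix}A & O\\ B & C\end{bmatrix}$, where $B$ is nowhere zero and both $A$ and $C$ have the strong inner product property. Then $Q$ has the strong inner product property.
   Context: All matrices are real; $\circ$ denotes the Hadamard product; a matrix is nowhere zero if all of its entries are nonzero. A matrix $M\in\mathbb{R}^{k\times l}$ with $k\le l$ has the strong inner product property (SIPP) if $M$ has rank $k$ and $X=O$ is the only symmetric $k\times k$ matrix $X$ with $(XM)\circ M=O$. -}

module Defs where

open import Level using (0ℓ)
open import Data.Nat using (ℕ) renaming (_+_ to _+ℕ_)
open import Data.Fin using (Fin; splitAt; _≟_)
open import Data.Sum using (inj₁; inj₂)
open import Data.Product using (Σ; ∃; _×_)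
open import Relation.Nullary using (¬_; yes; no)
open import Relation.Binary using (IsTotalOrder)
open import Algebra.Bundles using (CommutativeRing)
import Algebra.Properties.Monoid.Sum as MonoidSum

-- An axiomatisation of the real numbers: a complete ordered field.
-- (Every model is isomorphic to ℝ; agda-stdlib has no reals.)
record RealField : Set₁ where
  field
    commRing : CommutativeRing 0ℓ 0ℓ
  open CommutativeRing commRing public
  field
    0≉1      : ¬ (0# ≈ 1#)
    inverse  : ∀ x → ¬ (x ≈ 0#) → ∃ λ y → x * y ≈ 1#
    _≤_      : Carrier → Carrier → Set
    isTotalOrder : IsTotalOrder _≈_ _≤_
    +-mono-≤ : ∀ {x y} z → x ≤ y → (x + z) ≤ (y + z)
    *-nonneg : ∀ {x y} → 0# ≤ x → 0# ≤ y → 0# ≤ (x * y)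
    complete : (P : Carrier → Set) → ∃ P → (∃ λ u → ∀ x → P x → x ≤ u) →
               ∃ λ s → (∀ x → P x → x ≤ s) ×
                       (∀ u → (∀ x → P x → x ≤ u) → s ≤ u)

module Matrices (ℝ : RealField) where
  open RealField ℝ
  open MonoidSum +-monoid using (sum)

  Matrix : ℕ → ℕ → Set
  Matrix k l = Fin k → Fin l → Carrier

  _⊗_ : ∀ {k l t} → Matrix k l → Matrix l t → Matrix k t
  (M ⊗ N) i j = sum (λ h → M i h * N h j)

  _ᵀ : ∀ {k l} → Matrix k l → Matrix l k
  (M ᵀ) i j = M j i

  _∘ₕ_ : ∀ {k l} → Matrix k l → Matrix k l → Matrix k l
  (M ∘ₕ N) i j = M i j * N i j

  O : ∀ {k l} → Matrix k l
  O i j = 0#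

  I : ∀ {k} → Matrix k k
  I i j with i ≟ j
  ... | yes _ = 1#
  ... | no _  = 0#

  _≈ₘ_ : ∀ {k l} → Matrix k l → Matrix k l → Set
  M ≈ₘ N = ∀ i j → M i j ≈ N i j

  Symmetric : ∀ {k} → Matrix k k → Set
  Symmetric X = X ≈ₘ (X ᵀ)

  NowhereZero : ∀ {k l} → Matrix k l → Set
  NowhereZero M = ∀ i j → ¬ (M i j ≈ 0#)

  HasFullRowRank : ∀ {k l} → Matrix k l → Set
  HasFullRowRank {k} M =
    (c : Fin k → Carrier) → (∀ j → sum (λ i → c i * M i j) ≈ 0#) → ∀ i → c i ≈ 0#

  SIPP : ∀ {k l} → Matrix k l → Set
  SIPP {k} M = HasFullRowRank M ×
    ((X : Matrix k k) → Symmetric X → ((X ⊗ M) ∘ₕ M) ≈ₘ O → X ≈ₘ O)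

  blockLowerTri : ∀ {p q r s} → Matrix p q → Matrix r q → Matrix r s →
                  Matrix (p +ℕ r) (q +ℕ s)
  blockLowerTri {p} {q} A B C i j with splitAt p i | splitAt q j
  ... | inj₁ i₁ | inj₁ j₁ = A i₁ j₁
  ... | inj₁ i₁ | inj₂ j₂ = 0#
  ... | inj₂ i₂ | inj₁ j₁ = B i₂ j₁
  ... | inj₂ i₂ | inj₂ j₂ = C i₂ j₂

-- Read the condition (X Q) ∘ Q = O block by block, writing X = [ X₁₁ X₁₂ ; X₂₁ X₂₂ ].
-- The lower right block is (X₂₂ C) ∘ C = O, so X₂₂ = O because C has the SIPP.
-- The lower left block is (X₂₁ A + X₂₂ B) ∘ B = O; as B is nowhere zero this
-- gives X₂₁ A = O, hence X₂₁ = O because A has full row rank, and X₁₂ = X₂₁ᵀ = O.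
-- The upper left block is then (X₁₁ A) ∘ A = O, so X₁₁ = O because A has the SIPP.
-- Full row rank of Q follows from Q Qᵀ = I.
module Submission where

open import Defs
open import Data.Nat using (ℕ; zero; suc; _+_; _≤_)

open import Algebra.Bundles using (Monoid)
import Algebra.Properties.Monoid.Sum as MonoidSum
import Algebra.Properties.Semiring.Sum as SemiringSum
open import Data.Fin using (Fin; zero; suc; _↑ˡ_; _↑ʳ_; splitAt; punchIn; _≟_)
open import Data.Fin.Properties using (splitAt-↑ˡ; splitAt-↑ʳ; join-splitAt; punchInᵢ≢i)
open import Data.Product using (_,_)
open import Data.Sum using (inj₁; inj₂)
open import Data.Empty using (⊥-elim)
open import Function using (id)
open import Relation.Nullary using (¬_; yes; no)
open import Relation.Binary.PropositionalEquality as ≡ using (_≡_; _≢_)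
import Relation.Binary.Reasoning.Setoid as SetoidReasoning

↑ˡ-↑ʳ-elim : ∀ {ℓ} m n (P : Fin (m + n) → Set ℓ) →
             (∀ i → P (i ↑ˡ n)) → (∀ j → P (m ↑ʳ j)) → ∀ k → P k
↑ˡ-↑ʳ-elim m n P left right k with splitAt m k | join-splitAt m n k
... | inj₁ i | ≡.refl = left i
... | inj₂ j | ≡.refl = right j

module _ {c ℓ} (M : Monoid c ℓ) where
  open Monoid M
  open MonoidSum M using (sum; sum-cong-≋; sum-replicate-zero)

  sum-↑ : ∀ m n (f : Fin (m + n) → Carrier) →
          sum f ≈ sum (λ i → f (i ↑ˡ n)) ∙ sum (λ j → f (m ↑ʳ j))
  sum-↑ zero    n f = sym (identityˡ _)
  sum-↑ (suc m) n f = trans (∙-congˡ (sum-↑ m n (λ k → f (suc k)))) (sym (assoc _ _ _))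

  sum-zero : ∀ {n} {f : Fin n → Carrier} → (∀ i → f i ≈ ε) → sum f ≈ ε
  sum-zero {n} f≈ε = trans (sum-cong-≋ f≈ε) (sum-replicate-zero n)

module _ (ℝ : RealField) where
  open RealField ℝ hiding (zero; _≤_) renaming (_+_ to _+ᵣ_)
  open Matrices ℝ
  open SemiringSum semiring using (sum; sum-cong-≋; sum-remove; ∑-comm; *-distribˡ-sum; *-distribʳ-sum)
  open SetoidReasoning setoid

  x*y≈0⇒x≈0 : ∀ {x y} → x * y ≈ 0# → ¬ (y ≈ 0#) → x ≈ 0#
  x*y≈0⇒x≈0 {x} {y} xy≈0 y≉0 with inverse y y≉0
  ... | y⁻¹ , yy⁻¹≈1 = begin
    x              ≈⟨ *-identityʳ x ⟨
    x * 1#         ≈⟨ *-congˡ yy⁻¹≈1 ⟨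
    x * (y * y⁻¹)  ≈⟨ *-assoc x y y⁻¹ ⟨
    (x * y) * y⁻¹  ≈⟨ *-congʳ xy≈0 ⟩
    0# * y⁻¹       ≈⟨ zeroˡ y⁻¹ ⟩
    0#             ∎

  I-diagonal : ∀ {n} (i : Fin n) → I i i ≈ 1#
  I-diagonal i with i ≟ i
  ... | yes _  = refl
  ... | no i≢i = ⊥-elim (i≢i ≡.refl)

  I-offDiagonal : ∀ {n} {i j : Fin n} → i ≢ j → I i j ≈ 0#
  I-offDiagonal {i = i} {j} i≢j with i ≟ j
  ... | yes i≡j = ⊥-elim (i≢j i≡j)
  ... | no _    = refl

  sum-*-I : ∀ {n} (c : Fin n → Carrier) k → sum (λ i → c i * I i k) ≈ c k
  sum-*-I {suc n} c k = begin
    sum (λ i → c i * I i k)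
      ≈⟨ sum-remove {i = k} (λ i → c i * I i k) ⟩
    c k * I k k +ᵣ sum (λ j → c (punchIn k j) * I (punchIn k j) k)
      ≈⟨ +-cong (*-congˡ (I-diagonal k))
                (sum-zero +-monoid (λ j → trans (*-congˡ (I-offDiagonal (punchInᵢ≢i k j))) (zeroʳ _))) ⟩
    c k * 1# +ᵣ 0#
      ≈⟨ trans (+-identityʳ _) (*-identityʳ _) ⟩
    c k ∎

  orthonormalRows⇒fullRowRank : ∀ {k l} {M : Matrix k l} → (M ⊗ (M ᵀ)) ≈ₘ I → HasFullRowRank M
  orthonormalRows⇒fullRowRank {M = M} MMᵀ≈I c cM≈0 i = begin
    c i
      ≈⟨ sum-*-I c i ⟨
    sum (λ h → c h * I h i)
      ≈⟨ sum-cong-≋ (λ h → *-congˡ {c h} (MMᵀ≈I h i)) ⟨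
    sum (λ h → c h * sum (λ j → M h j * M i j))
      ≈⟨ sum-cong-≋ (λ h → *-distribˡ-sum (c h) (λ j → M h j * M i j)) ⟩
    sum (λ h → sum (λ j → c h * (M h j * M i j)))
      ≈⟨ ∑-comm (λ h j → c h * (M h j * M i j)) ⟩
    sum (λ j → sum (λ h → c h * (M h j * M i j)))
      ≈⟨ sum-cong-≋ (λ j → sum-cong-≋ (λ h → *-assoc (c h) (M h j) (M i j))) ⟨
    sum (λ j → sum (λ h → (c h * M h j) * M i j))
      ≈⟨ sum-cong-≋ (λ j → *-distribʳ-sum (M i j) (λ h → c h * M h j)) ⟨
    sum (λ j → sum (λ h → c h * M h j) * M i j)
      ≈⟨ sum-zero +-monoid (λ j → trans (*-congʳ (cM≈0 j)) (zeroˡ _)) ⟩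
    0# ∎

  fullRowRank⇒⊗-cancelʳ : ∀ {k l t} {M : Matrix k l} {Y : Matrix t k} →
                          HasFullRowRank M → (Y ⊗ M) ≈ₘ O → Y ≈ₘ O
  fullRowRank⇒⊗-cancelʳ rankM YM≈O a = rankM _ (YM≈O a)

  infix 30 _[_,_]
  _[_,_] : ∀ {k l k′ l′} → Matrix k l → (Fin k′ → Fin k) → (Fin l′ → Fin l) → Matrix k′ l′
  (M [ f , g ]) i j = M (f i) (g j)

  module _ {p q r s : ℕ} (A : Matrix p q) (B : Matrix r q) (C : Matrix r s) where
    private
      Q = blockLowerTri A B C

    blockLowerTri-↑ˡ-↑ˡ : ∀ i j → Q (i ↑ˡ r) (j ↑ˡ s) ≡ A i j
    blockLowerTri-↑ˡ-↑ˡ i j rewrite splitAt-↑ˡ p i r | splitAt-↑ˡ q j s = ≡.refl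

    blockLowerTri-↑ˡ-↑ʳ : ∀ i j → Q (i ↑ˡ r) (q ↑ʳ j) ≡ 0#
    blockLowerTri-↑ˡ-↑ʳ i j rewrite splitAt-↑ˡ p i r | splitAt-↑ʳ q s j = ≡.refl

    blockLowerTri-↑ʳ-↑ˡ : ∀ i j → Q (p ↑ʳ i) (j ↑ˡ s) ≡ B i j
    blockLowerTri-↑ʳ-↑ˡ i j rewrite splitAt-↑ʳ p r i | splitAt-↑ˡ q j s = ≡.refl

    blockLowerTri-↑ʳ-↑ʳ : ∀ i j → Q (p ↑ʳ i) (q ↑ʳ j) ≡ C i j
    blockLowerTri-↑ʳ-↑ʳ i j rewrite splitAt-↑ʳ p r i | splitAt-↑ʳ q s j = ≡.refl

    ⊗-blockLowerTri-↑ˡ : ∀ {k} (X : Matrix k (p + r)) i j →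
      (X ⊗ Q) i (j ↑ˡ s) ≈ (X [ id , _↑ˡ r ] ⊗ A) i j +ᵣ (X [ id , p ↑ʳ_ ] ⊗ B) i j
    ⊗-blockLowerTri-↑ˡ X i j = trans (sum-↑ +-monoid p r _) (+-cong
      (sum-cong-≋ (λ h → *-congˡ (reflexive (blockLowerTri-↑ˡ-↑ˡ h j))))
      (sum-cong-≋ (λ h → *-congˡ (reflexive (blockLowerTri-↑ʳ-↑ˡ h j)))))

    ⊗-blockLowerTri-↑ʳ : ∀ {k} (X : Matrix k (p + r)) i j →
      (X ⊗ Q) i (q ↑ʳ j) ≈ (X [ id , p ↑ʳ_ ] ⊗ C) i j
    ⊗-blockLowerTri-↑ʳ X i j = begin
      (X ⊗ Q) i (q ↑ʳ j)
        ≈⟨ sum-↑ +-monoid p r _ ⟩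
      sum (λ h → X i (h ↑ˡ r) * Q (h ↑ˡ r) (q ↑ʳ j)) +ᵣ sum (λ h → X i (p ↑ʳ h) * Q (p ↑ʳ h) (q ↑ʳ j))
        ≈⟨ +-cong (sum-zero +-monoid (λ h → trans (*-congˡ (reflexive (blockLowerTri-↑ˡ-↑ʳ h j))) (zeroʳ _)))
                  (sum-cong-≋ (λ h → *-congˡ (reflexive (blockLowerTri-↑ʳ-↑ʳ h j)))) ⟩
      0# +ᵣ (X [ id , p ↑ʳ_ ] ⊗ C) i j
        ≈⟨ +-identityˡ _ ⟩
      (X [ id , p ↑ʳ_ ] ⊗ C) i j ∎

    blockLowerTri-SIPP-kernel : NowhereZero B → SIPP A → SIPP C →
      (X : Matrix (p + r) (p + r)) → Symmetric X → ((X ⊗ Q) ∘ₕ Q) ≈ₘ O → X ≈ₘ O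
    blockLowerTri-SIPP-kernel nzB (rankA , kernelA) (_ , kernelC) X symX XQ∘Q≈O =
      ↑ˡ-↑ʳ-elim p r (λ i → ∀ j → X i j ≈ 0#)
        (λ a → ↑ˡ-↑ʳ-elim p r _ (X₁₁≈O a) (λ b → trans (symX _ _) (X₂₁≈O b a)))
        (λ a → ↑ˡ-↑ʳ-elim p r _ (X₂₁≈O a) (X₂₂≈O a))
      where
      X₂₂≈O : X [ p ↑ʳ_ , p ↑ʳ_ ] ≈ₘ O
      X₂₂≈O = kernelC _ (λ _ _ → symX _ _) λ a b →
        trans (*-cong (sym (⊗-blockLowerTri-↑ʳ X (p ↑ʳ a) b))
                      (sym (reflexive (blockLowerTri-↑ʳ-↑ʳ a b))))
              (XQ∘Q≈O (p ↑ʳ a) (q ↑ʳ b))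

      X₂₁A≈O : (X [ p ↑ʳ_ , _↑ˡ r ] ⊗ A) ≈ₘ O
      X₂₁A≈O a b = begin
        (X [ p ↑ʳ_ , _↑ˡ r ] ⊗ A) a b
          ≈⟨ +-identityʳ _ ⟨
        (X [ p ↑ʳ_ , _↑ˡ r ] ⊗ A) a b +ᵣ 0#
          ≈⟨ +-congˡ (sum-zero +-monoid (λ h → trans (*-congʳ (X₂₂≈O a h)) (zeroˡ _))) ⟨
        (X [ p ↑ʳ_ , _↑ˡ r ] ⊗ A) a b +ᵣ (X [ p ↑ʳ_ , p ↑ʳ_ ] ⊗ B) a b
          ≈⟨ ⊗-blockLowerTri-↑ˡ X (p ↑ʳ a) b ⟨
        (X ⊗ Q) (p ↑ʳ a) (b ↑ˡ s)
          ≈⟨ x*y≈0⇒x≈0 (XQ∘Q≈O (p ↑ʳ a) (b ↑ˡ s))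
                        (λ Q≈0 → nzB a b (trans (sym (reflexive (blockLowerTri-↑ʳ-↑ˡ a b))) Q≈0)) ⟩
        0# ∎

      X₂₁≈O : X [ p ↑ʳ_ , _↑ˡ r ] ≈ₘ O
      X₂₁≈O = fullRowRank⇒⊗-cancelʳ rankA X₂₁A≈O

      X₁₁≈O : X [ _↑ˡ r , _↑ˡ r ] ≈ₘ O
      X₁₁≈O = kernelA _ (λ _ _ → symX _ _) λ a b → begin
        (X [ _↑ˡ r , _↑ˡ r ] ⊗ A) a b * A a b
          ≈⟨ *-congʳ (+-identityʳ _) ⟨
        ((X [ _↑ˡ r , _↑ˡ r ] ⊗ A) a b +ᵣ 0#) * A a b
          ≈⟨ *-congʳ (+-congˡ (sum-zero +-monoid (λ h →
               trans (*-congʳ (trans (symX _ _) (X₂₁≈O h a))) (zeroˡ _)))) ⟨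
        ((X [ _↑ˡ r , _↑ˡ r ] ⊗ A) a b +ᵣ (X [ _↑ˡ r , p ↑ʳ_ ] ⊗ B) a b) * A a b
          ≈⟨ *-cong (⊗-blockLowerTri-↑ˡ X (a ↑ˡ r) b) (reflexive (blockLowerTri-↑ˡ-↑ˡ a b)) ⟨
        (X ⊗ Q) (a ↑ˡ r) (b ↑ˡ s) * Q (a ↑ˡ r) (b ↑ˡ s)
          ≈⟨ XQ∘Q≈O (a ↑ˡ r) (b ↑ˡ s) ⟩
        0# ∎

proposition5p5 : (ℝ : RealField) → let open Matrices ℝ in
    (p q r s : ℕ) → p + r ≤ q + s →
    (A : Matrix p q) (B : Matrix r q) (C : Matrix r s) →
    (blockLowerTri A B C ⊗ (blockLowerTri A B C ᵀ)) ≈ₘ I →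
    NowhereZero B → SIPP A → SIPP C →
    SIPP (blockLowerTri A B C)
proposition5p5 ℝ p q r s _ A B C QQᵀ≈I nzB sippA sippC =
  orthonormalRows⇒fullRowRank ℝ QQᵀ≈I ,
  blockLowerTri-SIPP-kernel ℝ A B C nzB sippA sippC
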